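{- Let $U$ be a finite poset, let $n,k\in\mathbb{N}_0$, and let $p=\min\{p'\in\mathbb{N}_0: U \text{ order-embeds into } \mathcal{P}([p'])\}$. Define $\mathrm{Sp}(U,n)=\max\{k'\in\mathbb{N}_0: k'U \text{ order-embeds into } \mathcal{P}([n])\}$, $\mathrm{Asp}(U,k)=\min\{n'\in\mathbb{N}_0: kU \text{ order-embeds into } \mathcal{P}([n'])\}$, $s(m)=\binom{m}{\lfloor m/2\rfloor}$ for $m\in\mathbb{N}_0$, and $s^\ast(k)=\min\{m\in\mathbb{N}_0: k\le s(m)\}$. Then: (a) if $n\geq p$, then $\mathrm{Sp}(U,n)\geq \binom{n-p}{\lfloor (n-p)/2\rfloor}$; (b) if $k\geq 1$, then $\mathrm{Asp}(U,k)\le p+s^\ast(k)$; (c) if $U$ is bounded and $n\ge p$, then $\mathrm{Sp}(U,n)=\binom{n-p}{\lfloor (n-p)/2\rfloor}$; (d) if $U$ is bounded and $k\geq 1$, then $\mathrm{Asp}(U,k)=p+s^\ast(k)$.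
   Context: $\mathbb{N}_0=\{0,1,2,\dots\}$; $[n]=\{1,\dots,n\}$, $[0]=\emptyset$; $\mathcal{P}([n])$ is the powerset of $[n]$ ordered by inclusion. For a poset $U$ and $k\in\mathbb{N}_0$, $kU$ is the cardinal sum of $k$ disjoint isomorphic copies of $U$ (elements of different copies incomparable); $0U$ is the empty poset, which embeds into every poset. An order embedding is a map $\phi$ with $x\le y\iff\phi(x)\le\phi(y)$. A poset is bounded if it has a least and a greatest element. -}

module Defs where

open import Data.Nat using (ℕ; _≤_; _/_)
open import Data.Nat.Combinatorics using (_C_)
open import Data.Fin using (Fin)
open import Data.Fin.Subset using (Subset; _⊆_)
open import Data.Product using (Σ; _×_; ∃)
open import Relation.Binary.PropositionalEquality using (_≡_)
open import Relation.Binary.Structures using (IsPartialOrder)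
open import Relation.Binary.Definitions using (Decidable)

record FinPoset : Set₁ where
  field
    size  : ℕ
    _≼_   : Fin size → Fin size → Set
    isPO  : IsPartialOrder _≡_ _≼_
    _≼?_  : Decidable _≼_

open FinPoset public

OrderEmbedsInto : {A : Set} → (A → A → Set) → ℕ → Set
OrderEmbedsInto {A} R n =
  Σ (A → Subset n) λ φ → ∀ x y → (R x y → φ x ⊆ φ y) × (φ x ⊆ φ y → R x y)

Embeds : FinPoset → ℕ → Set
Embeds U n = OrderEmbedsInto (_≼_ U) n

CopyLe : (k : ℕ) (U : FinPoset) → Fin k × Fin (size U) → Fin k × Fin (size U) → Set
CopyLe k U (i Data.Product., x) (j Data.Product., y) = (i ≡ j) × (_≼_ U x y)

CopiesEmbed : ℕ → FinPoset → ℕ → Set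
CopiesEmbed k U n = OrderEmbedsInto (CopyLe k U) n

IsMin : (ℕ → Set) → ℕ → Set
IsMin P m = P m × (∀ m' → P m' → m ≤ m')

IsMax : (ℕ → Set) → ℕ → Set
IsMax P m = P m × (∀ m' → P m' → m' ≤ m)

s : ℕ → ℕ
s m = m C (m / 2)

IsBounded : FinPoset → Set
IsBounded U = (∃ λ b → ∀ x → _≼_ U b x) × (∃ λ t → ∀ x → _≼_ U x t)

-- If U embeds into P([p]), then putting the members of a middle layer of P([m]) on
-- top of the embedding (on m new points) gives C(m, ⌊m/2⌋) pairwise incomparable copies
-- of U in P([p + m]). Conversely, if U is bounded, the i-th of k disjoint copies in
-- P([n]) lies in the interval [Aᵢ, Bᵢ] spanned by the images of its bottom and top, so
-- |Bᵢ ∖ Aᵢ| ≥ p, while Aᵢ ⊄ Bⱼ for i ≠ j. Bollobás's inequality for the pairs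
-- (Aᵢ, [n] ∖ Bᵢ) then gives k / C(n − p, ⌊(n − p)/2⌋) ≤ ∑ᵢ 1 / C(n − |Bᵢ ∖ Aᵢ|, |Aᵢ|) ≤ 1.
module Submission where

open import Defs
open import Data.Nat using (ℕ; _≤_; _+_; _∸_)
open import Data.Product using (_×_; ∃)

open import Data.Bool using (Bool; true; false; if_then_else_; _∧_)
import Data.Bool.Properties as Boolₚ
open import Data.Empty using (⊥-elim)
open import Data.Fin as Fin using (Fin; punchOut)
import Data.Fin.Properties as Finₚ
open import Data.Fin.Subset using (Subset; _⊆_; _⊈_; ∣_∣; inside; outside; ⊥)
open import Data.Fin.Subset.Properties using (drop-∷-⊆; out⊆; in⊆in; ⊆-refl; p⊆q⇒∣p∣≤∣q∣; ∣⊥∣≡0)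
open import Data.Nat using (zero; suc; _*_; _<_; z≤n; s≤s; _/_; _%_; _!; NonZero; >-nonZero)
open import Data.Nat.Combinatorics
  using (_C_; nCk+nC[k+1]≡[n+1]C[k+1]; nCk≡nC[n∸k]; k>n⇒nCk≡0; nCk≡n!/k![n-k]!; k![n∸k]!∣n!)
open import Data.Nat.DivMod using (m≡m%n+[m/n]*n; m%n<n; m/n*n≤m; m/n*n≡m)
open import Data.Nat.Properties
open import Data.Nat.Solver using (module +-*-Solver)
open import Data.Product using (_,_; proj₁; proj₂)
open import Data.Sum using (_⊎_; inj₁; inj₂; [_,_]′)
open import Data.Vec using ([]; _∷_; _++_; lookup; here)
open import Data.Vec.Functional using (removeAt)
open import Data.Vec.Functional.Properties using (removeAt-punchOut)
open import Function using (_∘_)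
open import Relation.Binary.PropositionalEquality
open import Relation.Nullary using (yes; no)
open import Relation.Nullary.Decidable using (_×-dec_)

open import Algebra.Properties.Semiring.Sum +-*-semiring
  using (sum; sum-cong-≗; sum-remove; ∑-comm; ∑-distrib-+; *-distribʳ-sum)
open import Algebra.Properties.CommutativeSemigroup *-commutativeSemigroup using (x∙yz≈y∙xz; xy∙z≈xz∙y)
open +-*-Solver using (solve; _:+_; _:*_; _:=_; con)

-- Binomial coefficients

_choose_ : ℕ → ℕ → ℕ
m     choose zero  = 1
zero  choose suc k = 0
suc m choose suc k = m choose k + m choose suc k

choose≡C : ∀ m k → m choose k ≡ m C k
choose≡C m       zero    = refl
choose≡C zero    (suc k) = refl
choose≡C (suc m) (suc k) =
  trans (cong₂ _+_ (choose≡C m k) (choose≡C m (suc k))) (nCk+nC[k+1]≡[n+1]C[k+1] m k)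

s≡choose : ∀ m → s m ≡ m choose (m / 2)
s≡choose m = sym (choose≡C m (m / 2))

choose-sym : ∀ {m k} → k ≤ m → m choose k ≡ m choose (m ∸ k)
choose-sym {m} {k} k≤m =
  trans (choose≡C m k) (trans (nCk≡nC[n∸k] k≤m) (sym (choose≡C m (m ∸ k))))

choose-> : ∀ {m k} → m < k → m choose k ≡ 0
choose-> {m} {k} m<k = trans (choose≡C m k) (k>n⇒nCk≡0 m<k)

choose-pos : ∀ {m k} → k ≤ m → 0 < m choose k
choose-pos {m}     {zero}  _         = s≤s z≤n
choose-pos {suc m} {suc k} (s≤s k≤m) = ≤-trans (choose-pos k≤m) (m≤m+n _ _)

choose-monoˡ-≤ : ∀ {m m′} k → m ≤ m′ → m choose k ≤ m′ choose k
choose-monoˡ-≤ zero    _         = ≤-refl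
choose-monoˡ-≤ (suc k) z≤n       = z≤n
choose-monoˡ-≤ (suc k) (s≤s m≤m′) = +-mono-≤ (choose-monoˡ-≤ k m≤m′) (choose-monoˡ-≤ (suc k) m≤m′)

choose-increasing : ∀ {m k} → suc (k + k) ≤ m → m choose k ≤ m choose suc k
choose-increasing {suc m} {zero}  _  = s≤s z≤n
choose-increasing {suc m} {suc k} (s≤s 2k+2≤m) = begin
  m choose k + m choose suc k        ≤⟨ +-monoˡ-≤ _ skip-two ⟩
  m choose suc (suc k) + m choose suc k ≡⟨ +-comm (m choose suc (suc k)) (m choose suc k) ⟩
  m choose suc k + m choose suc (suc k) ∎
  where
  open ≤-Reasoning
  skip-two : m choose k ≤ m choose suc (suc k)
  skip-two with m≤n⇒m<n∨m≡n 2k+2≤m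
  ... | inj₁ 2k+3≤m = ≤-trans (choose-increasing (≤-trans (s≤s (+-monoʳ-≤ k (n≤1+n k))) (<⇒≤ 2k+3≤m)))
                              (choose-increasing 2k+3≤m)
  -- for m = 2k + 2 the two sides are mirror images
  ... | inj₂ refl = ≤-reflexive (trans (choose-sym (≤-trans (m≤m+n k (suc k)) (n≤1+n _)))
                                       (cong (suc (k + suc k) choose_) m∸k≡k+2))
    where
    m∸k≡k+2 : suc (k + suc k) ∸ k ≡ suc (suc k)
    m∸k≡k+2 = trans (cong (_∸ k) (sym (+-suc k (suc k)))) (m+n∸m≡n k (suc (suc k)))

choose-monoʳ-≤ : ∀ {m k} h → k ≤ h → h + h ≤ m → m choose k ≤ m choose h
choose-monoʳ-≤ zero z≤n _ = ≤-refl
choose-monoʳ-≤ (suc h) k≤1+h 2h+2≤m with m≤n⇒m<n∨m≡n k≤1+h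
... | inj₂ refl      = ≤-refl
... | inj₁ (s≤s k≤h) =
  ≤-trans (choose-monoʳ-≤ h k≤h (≤-trans (n≤1+n _) 2h+1≤m)) (choose-increasing 2h+1≤m)
  where
  2h+1≤m : suc (h + h) ≤ _
  2h+1≤m = ≤-trans (s≤s (+-monoʳ-≤ h (n≤1+n h))) 2h+2≤m

half-bounds : ∀ m → m / 2 + m / 2 ≤ m × m ≤ suc (m / 2 + m / 2)
half-bounds m = subst (_≤ m) h*2≡h+h (m/n*n≤m m 2) , m≤2h+1
  where
  open ≤-Reasoning
  h = m / 2
  h*2≡h+h : h * 2 ≡ h + h
  h*2≡h+h = trans (*-comm h 2) (cong (h +_) (+-identityʳ h))
  m≤2h+1 : m ≤ suc (h + h)
  m≤2h+1 = begin
    m                  ≡⟨ m≡m%n+[m/n]*n m 2 ⟩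
    m % 2 + h * 2      ≤⟨ +-monoˡ-≤ (h * 2) (≤-pred (m%n<n m 2)) ⟩
    suc (h * 2)        ≡⟨ cong suc h*2≡h+h ⟩
    suc (h + h)        ∎

choose≤central : ∀ m k → m choose k ≤ m choose (m / 2)
choose≤central m k with k ≤? m / 2 | half-bounds m
... | yes k≤h | 2h≤m , _ = choose-monoʳ-≤ (m / 2) k≤h 2h≤m
... | no  k≰h | 2h≤m , m≤2h+1 with k ≤? m
...   | no  k≰m = ≤-trans (≤-reflexive (choose-> (≰⇒> k≰m))) z≤n
...   | yes k≤m = ≤-trans (≤-reflexive (choose-sym k≤m)) (choose-monoʳ-≤ (m / 2) m∸k≤h 2h≤m)
  where
  m∸k≤h : m ∸ k ≤ m / 2
  m∸k≤h = ≤-trans (∸-monoʳ-≤ m (≰⇒> k≰h)) (m≤n+o⇒m∸n≤o m (suc (m / 2)) m≤2h+1)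

!*!*choose≡! : ∀ a c → a ! * c ! * (a + c) choose a ≡ (a + c) !
!*!*choose≡! a c = begin
  a ! * c ! * (a + c) choose a  ≡⟨ cong₂ _*_ (cong (λ x → a ! * x !) (sym (m+n∸m≡n a c))) (choose≡C (a + c) a) ⟩
  D * ((a + c) C a)             ≡⟨ cong (D *_) (nCk≡n!/k![n-k]! (m≤m+n a c)) ⟩
  D * ((a + c) ! / D)           ≡⟨ *-comm D _ ⟩
  (a + c) ! / D * D             ≡⟨ m/n*n≡m (k![n∸k]!∣n! (m≤m+n a c)) ⟩
  (a + c) !                     ∎
  where
  open ≡-Reasoning
  D = a ! * (a + c ∸ a) !
  instance
    D≢0 : NonZero D
    D≢0 = m*n≢0 (a !) ((a + c ∸ a) !) {{a !≢0}} {{(a + c ∸ a) !≢0}}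

-- Bollobás's inequality

rising : ℕ → ℕ → ℕ
rising m zero    = 1
rising m (suc r) = suc (m + r) * rising m r

!*rising≡! : ∀ m r → m ! * rising m r ≡ (m + r) !
!*rising≡! m zero    = trans (*-identityʳ (m !)) (cong _! (sym (+-identityʳ m)))
!*rising≡! m (suc r) = begin
  m ! * (suc (m + r) * rising m r)  ≡⟨ x∙yz≈y∙xz (m !) (suc (m + r)) (rising m r) ⟩
  suc (m + r) * (m ! * rising m r)  ≡⟨ cong (suc (m + r) *_) (!*rising≡! m r) ⟩
  suc (m + r) * (m + r) !           ≡⟨ cong _! (sym (+-suc m r)) ⟩
  (m + suc r) !                     ∎
  where open ≡-Reasoning

rising-shift : ∀ m r → suc m * rising (suc m) r ≡ suc (m + r) * rising m r
rising-shift m zero    = cong (λ x → suc x * 1) (sym (+-identityʳ m))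
rising-shift m (suc r) = begin
  suc m * (suc (suc m + r) * rising (suc m) r)  ≡⟨ x∙yz≈y∙xz (suc m) (suc (suc m + r)) (rising (suc m) r) ⟩
  suc (suc m + r) * (suc m * rising (suc m) r)  ≡⟨ cong (suc (suc m + r) *_) (rising-shift m r) ⟩
  suc (suc m + r) * (suc (m + r) * rising m r)  ≡⟨ cong (λ x → suc x * (suc (m + r) * rising m r)) (sym (+-suc m r)) ⟩
  suc (m + suc r) * (suc (m + r) * rising m r)  ∎
  where open ≡-Reasoning

rising-pascal : ∀ m r → rising (suc m) r ≡ rising m r + r * rising (suc m) (r ∸ 1)
rising-pascal m zero    = refl
rising-pascal m (suc r) = begin
  suc (suc m + r) * x                  ≡⟨ cong (λ y → suc y * x) (sym (+-suc m r)) ⟩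
  suc (m + suc r) * x                  ≡⟨ solve 3 (λ m r x → (con 1 :+ (m :+ (con 1 :+ r))) :* x
                                                         := (con 1 :+ m) :* x :+ (con 1 :+ r) :* x) refl m r x ⟩
  suc m * x + suc r * x                ≡⟨ cong (_+ suc r * x) (rising-shift m r) ⟩
  suc (m + r) * rising m r + suc r * x ∎
  where
  open ≡-Reasoning
  x = rising (suc m) r

-- (a + c + r)! / C(a + c, a): the number of orderings of a + c + r objects
-- in which a designated a of them all come before a designated c of them.
orderings : ℕ → ℕ → ℕ → ℕ
orderings a c r = a ! * c ! * rising (a + c) r

orderings*choose≡! : ∀ a c r → orderings a c r * (a + c) choose a ≡ (a + c + r) !
orderings*choose≡! a c r = begin
  a ! * c ! * rising (a + c) r * (a + c) choose a  ≡⟨ xy∙z≈xz∙y (a ! * c !) (rising (a + c) r) ((a + c) choose a) ⟩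
  a ! * c ! * (a + c) choose a * rising (a + c) r  ≡⟨ cong (_* rising (a + c) r) (!*!*choose≡! a c) ⟩
  (a + c) ! * rising (a + c) r                     ≡⟨ !*rising≡! (a + c) r ⟩
  (a + c + r) !                                    ∎
  where open ≡-Reasoning

orderings≤! : ∀ a c r → orderings a c r ≤ (a + c + r) !
orderings≤! a c r = ≤-trans (m≤m*n (orderings a c r) ((a + c) choose a) {{>-nonZero (choose-pos (m≤m+n a c))}})
                            (≤-reflexive (orderings*choose≡! a c r))

-- Sort the orderings counted on the right by their last object: one of the
-- c designated ones, or one of the r others.
orderings-recurrence : ∀ a {c} r → 1 ≤ c →
  c * orderings a (c ∸ 1) r + r * orderings a c (r ∸ 1) ≡ orderings a c r
orderings-recurrence a {suc c} r _ = begin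
  suc c * (a ! * c ! * rising m r) + r * (a ! * (suc c * c !) * rising (a + suc c) (r ∸ 1))
    ≡⟨ cong (λ x → suc c * (a ! * c ! * rising m r) + r * (a ! * (suc c * c !) * rising x (r ∸ 1))) (+-suc a c) ⟩
  suc c * (a ! * c ! * rising m r) + r * (a ! * (suc c * c !) * rising (suc m) (r ∸ 1))
    ≡⟨ solve 6 (λ c A C x r y → (con 1 :+ c) :* (A :* C :* x) :+ r :* (A :* ((con 1 :+ c) :* C) :* y)
                             := A :* ((con 1 :+ c) :* C) :* (x :+ r :* y))
             refl c (a !) (c !) (rising m r) r (rising (suc m) (r ∸ 1)) ⟩
  a ! * (suc c * c !) * (rising m r + r * rising (suc m) (r ∸ 1))
    ≡⟨ cong (a ! * (suc c * c !) *_) (sym (rising-pascal m r)) ⟩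
  a ! * (suc c * c !) * rising (suc m) r
    ≡⟨ cong (λ x → a ! * (suc c * c !) * rising x r) (sym (+-suc a c)) ⟩
  a ! * (suc c * c !) * rising (a + suc c) r ∎
  where
  open ≡-Reasoning
  m = a + c

sum-mono-≤ : ∀ {n} {f g : Fin n → ℕ} → (∀ i → f i ≤ g i) → sum f ≤ sum g
sum-mono-≤ {zero}  f≤g = z≤n
sum-mono-≤ {suc n} f≤g = +-mono-≤ (f≤g Fin.zero) (sum-mono-≤ (f≤g ∘ Fin.suc))

sum-const : ∀ n c → sum {n} (λ _ → c) ≡ n * c
sum-const zero    c = refl
sum-const (suc n) c = cong (c +_) (sum-const n c)

≤-sum : ∀ {n} (t : Fin n → ℕ) i → t i ≤ sum t
≤-sum {suc n} t i = subst (t i ≤_) (sym (sum-remove t)) (m≤m+n (t i) _)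

sum≤-single-support : ∀ {k} (t : Fin k → ℕ) {M} → (∀ i j → t i ≢ 0 → t j ≢ 0 → i ≡ j) →
                      (∀ i → t i ≤ M) → sum t ≤ M
sum≤-single-support {zero}  t unique t≤M = z≤n
sum≤-single-support {suc k} t unique t≤M with t Fin.zero ≟ 0
... | yes t₀≡0 rewrite t₀≡0 =
  sum≤-single-support (t ∘ Fin.suc) (λ i j tᵢ≢0 tⱼ≢0 → Finₚ.suc-injective (unique _ _ tᵢ≢0 tⱼ≢0)) (t≤M ∘ Fin.suc)
... | no  t₀≢0 = ≤-trans (≤-reflexive (trans (cong (t Fin.zero +_) tail≡0) (+-identityʳ _))) (t≤M Fin.zero)
  where
  tail≡0 : sum (t ∘ Fin.suc) ≡ 0
  tail≡0 = trans (sum-cong-≗ vanishes) (trans (sum-const k 0) (*-zeroʳ k))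
    where
    vanishes : ∀ i → t (Fin.suc i) ≡ 0
    vanishes i with t (Fin.suc i) ≟ 0
    ... | yes tᵢ≡0 = tᵢ≡0
    ... | no  tᵢ≢0 = ⊥-elim (Finₚ.0≢1+n (sym (unique _ _ tᵢ≢0 t₀≢0)))

data Label : Set where
  inA inC free : Label

δ : Label → Label → ℕ
δ inA  inA  = 1
δ inC  inC  = 1
δ free free = 1
δ _    _    = 0

δ-self : ∀ l → δ l l ≡ 1
δ-self inA  = refl
δ-self inC  = refl
δ-self free = refl

count : ∀ {n} → Label → (Fin n → Label) → ℕ
count l f = sum (δ l ∘ f)

sum-∘-label : ∀ {n} (h : Label → ℕ) (f : Fin n → Label) →
  sum (h ∘ f) ≡ count inA f * h inA + count inC f * h inC + count free f * h free
sum-∘-label h f = begin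
  sum (h ∘ f)                                         ≡⟨ sum-cong-≗ (split ∘ f) ⟩
  sum (λ x → δA x * h inA + δC x * h inC + δF x * h free)
    ≡⟨ ∑-distrib-+ (λ x → δA x * h inA + δC x * h inC) (λ x → δF x * h free) ⟩
  sum (λ x → δA x * h inA + δC x * h inC) + sum (λ x → δF x * h free)
    ≡⟨ cong (_+ sum (λ x → δF x * h free)) (∑-distrib-+ (λ x → δA x * h inA) (λ x → δC x * h inC)) ⟩
  sum (λ x → δA x * h inA) + sum (λ x → δC x * h inC) + sum (λ x → δF x * h free)
    ≡⟨ sym (cong₂ _+_ (cong₂ _+_ (*-distribʳ-sum (h inA) δA) (*-distribʳ-sum (h inC) δC)) (*-distribʳ-sum (h free) δF)) ⟩
  count inA f * h inA + count inC f * h inC + count free f * h free ∎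
  where
  open ≡-Reasoning
  δA = δ inA ∘ f
  δC = δ inC ∘ f
  δF = δ free ∘ f
  split : ∀ l → h l ≡ δ inA l * h inA + δ inC l * h inC + δ free l * h free
  split inA  = sym (trans (+-identityʳ _) (trans (+-identityʳ _) (+-identityʳ _)))
  split inC  = sym (trans (+-identityʳ _) (+-identityʳ _))
  split free = sym (+-identityʳ _)

count-total : ∀ {n} (f : Fin n → Label) → count inA f + count inC f + count free f ≡ n
count-total {n} f = begin
  count inA f + count inC f + count free f
    ≡⟨ sym (cong₂ _+_ (cong₂ _+_ (*-identityʳ (count inA f)) (*-identityʳ (count inC f))) (*-identityʳ (count free f))) ⟩
  count inA f * 1 + count inC f * 1 + count free f * 1  ≡⟨ sym (sum-∘-label (λ _ → 1) f) ⟩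
  sum {n} (λ _ → 1)                                      ≡⟨ sum-const n 1 ⟩
  n * 1                                                  ≡⟨ *-identityʳ n ⟩
  n                                                      ∎
  where open ≡-Reasoning

count-removeAt : ∀ {n} (f : Fin (suc n) → Label) x l → count l (removeAt f x) ≡ count l f ∸ δ l (f x)
count-removeAt f x l = sym (trans (cong (_∸ δ l (f x)) (sum-remove {i = x} (δ l ∘ f))) (m+n∸m≡n (δ l (f x)) (count l (removeAt f x))))

count-pos : ∀ {n} (f : Fin n → Label) {y l} → f y ≡ l → 0 < count l f
count-pos f {y} refl = subst (_≤ count (f y) f) (δ-self (f y)) (≤-sum (δ (f y) ∘ f) y)

weight : ∀ {n} → (Fin n → Label) → ℕ
weight f = orderings (count inA f) (count inC f) (count free f)

weight≤! : ∀ {n} (f : Fin n → Label) → weight f ≤ n !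
weight≤! f = ≤-trans (orderings≤! (count inA f) (count inC f) (count free f)) (≤-reflexive (cong _! (count-total f)))

survives : Label → Bool
survives inA = false
survives _   = true

activeWeight : ∀ {n} → Bool → (Fin n → Label) → ℕ
activeWeight b f = if b then weight f else 0

weight-removeAt : ∀ {n} (f : Fin (suc n) → Label) x →
  weight (removeAt f x) ≡ orderings (count inA f ∸ δ inA (f x)) (count inC f ∸ δ inC (f x)) (count free f ∸ δ free (f x))
weight-removeAt f x rewrite count-removeAt f x inA | count-removeAt f x inC | count-removeAt f x free = refl

weight-by-last : ∀ {n} (f : Fin (suc n) → Label) → 0 < count inC f →
  weight f ≡ sum (λ x → activeWeight (survives (f x)) (removeAt f x))
weight-by-last f 0<c = sym (begin
  sum (λ x → activeWeight (survives (f x)) (removeAt f x))  ≡⟨ sum-cong-≗ deleted ⟩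
  sum (h ∘ f)                                               ≡⟨ sum-∘-label h f ⟩
  a * 0 + c * h inC + r * h free                            ≡⟨ cong (λ z → z + c * h inC + r * h free) (*-zeroʳ a) ⟩
  c * orderings a (c ∸ 1) r + r * orderings a c (r ∸ 1)    ≡⟨ orderings-recurrence a r 0<c ⟩
  weight f                                                  ∎)
  where
  open ≡-Reasoning
  a = count inA f
  c = count inC f
  r = count free f
  h : Label → ℕ
  h inA  = 0
  h inC  = orderings a (c ∸ 1) r
  h free = orderings a c (r ∸ 1)
  deleted : ∀ x → activeWeight (survives (f x)) (removeAt f x) ≡ h (f x)
  deleted x with f x | weight-removeAt f x
  ... | inA  | _ = refl
  ... | inC  | e = e
  ... | free | e = e

Separated : ∀ {n} → (Fin n → Label) → (Fin n → Label) → Set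
Separated f g = ∃ λ y → f y ≡ inA × g y ≡ inC

PairwiseSeparated : ∀ {n k} → (Fin k → Fin n → Label) → (Fin k → Bool) → Set
PairwiseSeparated L active =
  ∀ {i j} → i ≢ j → active i ≡ true → active j ≡ true → Separated (L i) (L j)

activeWeights≤!-single : ∀ {n k} (L : Fin k → Fin n → Label) (active : Fin k → Bool) →
  (∀ {i j} → active i ≡ true → active j ≡ true → i ≡ j) →
  sum (λ i → activeWeight (active i) (L i)) ≤ n !
activeWeights≤!-single L active unique =
  sum≤-single-support _ (λ i j wᵢ≢0 wⱼ≢0 → unique (active-if-nonzero i wᵢ≢0) (active-if-nonzero j wⱼ≢0))
                        (λ i → activeWeight≤! (active i) (L i))
  where
  active-if-nonzero : ∀ i → activeWeight (active i) (L i) ≢ 0 → active i ≡ true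
  active-if-nonzero i w≢0 with active i
  ... | true  = refl
  ... | false = ⊥-elim (w≢0 refl)
  activeWeight≤! : ∀ {n} b (f : Fin n → Label) → activeWeight b f ≤ n !
  activeWeight≤! true  f = weight≤! f
  activeWeight≤! false f = z≤n

-- Bollobás's inequality ∑ 1 / C(|Aᵢ| + |Cᵢ|, |Aᵢ|) ≤ 1 for the active pairs Aᵢ = Lᵢ⁻¹(inA),
-- Cᵢ = Lᵢ⁻¹(inC), multiplied by n!. Deleting a point x keeps exactly the pairs with x ∉ Aᵢ.
bollobás : ∀ n {k} (L : Fin k → Fin n → Label) (active : Fin k → Bool) →
  PairwiseSeparated L active → sum (λ i → activeWeight (active i) (L i)) ≤ n !
bollobás zero L active separated = activeWeights≤!-single L active unique
  where
  unique : ∀ {i j} → active i ≡ true → active j ≡ true → i ≡ j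
  unique {i} {j} aᵢ aⱼ with i Finₚ.≟ j
  ... | yes i≡j = i≡j
  ... | no  i≢j with separated i≢j aᵢ aⱼ
  ...   | () , _
bollobás (suc n) {k} L active separated
  with Finₚ.any? (λ i → (active i Boolₚ.≟ true) ×-dec (count inC (L i) ≟ 0))
... | yes (i₀ , aᵢ₀ , noC) = activeWeights≤!-single L active unique
  where
  only-i₀ : ∀ {j} → active j ≡ true → j ≡ i₀
  only-i₀ {j} aⱼ with j Finₚ.≟ i₀
  ... | yes j≡i₀ = j≡i₀
  ... | no  j≢i₀ with separated j≢i₀ aⱼ aᵢ₀
  ...   | y , _ , inC∈Cᵢ₀ = ⊥-elim (<⇒≢ (count-pos (L i₀) inC∈Cᵢ₀) (sym noC))
  unique : ∀ {i j} → active i ≡ true → active j ≡ true → i ≡ j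
  unique aᵢ aⱼ = trans (only-i₀ aᵢ) (sym (only-i₀ aⱼ))
... | no  noEmptyC = begin
  sum (λ i → activeWeight (active i) (L i))                                ≡⟨ sum-cong-≗ by-last ⟩
  sum (λ i → sum (λ x → activeWeight (active′ x i) (removeAt (L i) x)))    ≡⟨ ∑-comm (λ i x → activeWeight (active′ x i) (removeAt (L i) x)) ⟩
  sum (λ x → sum (λ i → activeWeight (active′ x i) (removeAt (L i) x)))    ≤⟨ sum-mono-≤ (λ x → bollobás n (λ i → removeAt (L i) x) (active′ x) (separated′ x)) ⟩
  sum {suc n} (λ _ → n !)                                                  ≡⟨ sum-const (suc n) (n !) ⟩
  suc n !                                                                  ∎
  where
  open ≤-Reasoning
  active′ : Fin (suc n) → Fin k → Bool
  active′ x i = active i ∧ survives (L i x)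
  by-last : ∀ i → activeWeight (active i) (L i) ≡ sum (λ x → activeWeight (active′ x i) (removeAt (L i) x))
  by-last i with active i in aᵢ
  ... | false = sym (trans (sum-const (suc n) 0) (*-zeroʳ (suc n)))
  ... | true  = weight-by-last (L i) (n≢0⇒n>0 (λ noC → noEmptyC (i , aᵢ , noC)))
  separated′ : ∀ x → PairwiseSeparated (λ i → removeAt (L i) x) (active′ x)
  separated′ x {i} {j} i≢j aᵢ aⱼ with active i in aᵢ′ | active j in aⱼ′
  ... | true | true with separated i≢j aᵢ′ aⱼ′
  ...   | y , inA∈Aᵢ , inC∈Cⱼ = punchOut x≢y , trans (removeAt-punchOut (L i) x≢y) inA∈Aᵢ
                                                , trans (removeAt-punchOut (L j) x≢y) inC∈Cⱼ
    where
    x≢y : x ≢ y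
    x≢y refl with () ← trans (cong survives (sym inA∈Aᵢ)) aᵢ

-- Middle layers and disjoint copies

head-⊆ : ∀ {n s t} {p q : Subset n} → s ∷ p ⊆ t ∷ q → s ≡ true → t ≡ true
head-⊆ s∷p⊆t∷q refl with s∷p⊆t∷q here
... | here = refl

∷⊆∷ : ∀ {n s t} {p q : Subset n} → (s ≡ true → t ≡ true) → p ⊆ q → s ∷ p ⊆ t ∷ q
∷⊆∷ {s = false} _   p⊆q = out⊆ p⊆q
∷⊆∷ {s = true}  s→t p⊆q rewrite s→t refl = in⊆in p⊆q

++⊆++ : ∀ {m n} {u u′ : Subset m} {v v′ : Subset n} → u ⊆ u′ → v ⊆ v′ → u ++ v ⊆ u′ ++ v′
++⊆++ {u = []}    {[]}     _    v⊆v′ = v⊆v′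
++⊆++ {u = _ ∷ _} {_ ∷ _} u⊆u′ v⊆v′ = ∷⊆∷ (head-⊆ u⊆u′) (++⊆++ (drop-∷-⊆ u⊆u′) v⊆v′)

++⊆++⁻ : ∀ {m n} (u u′ : Subset m) {v v′ : Subset n} → u ++ v ⊆ u′ ++ v′ → u ⊆ u′ × v ⊆ v′
++⊆++⁻ []      []       uv⊆u′v′ = (λ ()) , uv⊆u′v′
++⊆++⁻ (_ ∷ u) (_ ∷ u′) uv⊆u′v′ =
  ∷⊆∷ (head-⊆ uv⊆u′v′) (proj₁ (++⊆++⁻ u u′ (drop-∷-⊆ uv⊆u′v′))) , proj₂ (++⊆++⁻ u u′ (drop-∷-⊆ uv⊆u′v′))

mutual
  layer : ∀ m j → Fin (m choose j) → Subset m
  layer m       zero    _ = ⊥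
  layer (suc m) (suc j)   = layer-suc m j ∘ Fin.splitAt (m choose j)

  layer-suc : ∀ m j → Fin (m choose j) ⊎ Fin (m choose suc j) → Subset (suc m)
  layer-suc m j = [ (inside ∷_) ∘ layer m j , (outside ∷_) ∘ layer m (suc j) ]′

∣layer∣ : ∀ m j i → ∣ layer m j i ∣ ≡ j
∣layer∣ m       zero    _ = ∣⊥∣≡0 m
∣layer∣ (suc m) (suc j) i with Fin.splitAt (m choose j) i
... | inj₁ a = cong suc (∣layer∣ m j a)
... | inj₂ b = ∣layer∣ m (suc j) b

layer-antichain : ∀ m j {i i′} → layer m j i ⊆ layer m j i′ → i ≡ i′
layer-antichain m       zero    {Fin.zero} {Fin.zero} _ = refl
layer-antichain (suc m) (suc j) {i} {i′} i⊆i′ = begin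
  i                                            ≡⟨ sym (Finₚ.join-splitAt (m choose j) _ i) ⟩
  Fin.join _ _ (Fin.splitAt (m choose j) i)    ≡⟨ cong (Fin.join _ _) (halves (Fin.splitAt (m choose j) i) (Fin.splitAt (m choose j) i′) i⊆i′) ⟩
  Fin.join _ _ (Fin.splitAt (m choose j) i′)   ≡⟨ Finₚ.join-splitAt (m choose j) _ i′ ⟩
  i′                                           ∎
  where
  open ≡-Reasoning
  halves : ∀ u v → layer-suc m j u ⊆ layer-suc m j v → u ≡ v
  halves (inj₁ a) (inj₁ a′) u⊆v = cong inj₁ (layer-antichain m j (drop-∷-⊆ u⊆v))
  halves (inj₁ a) (inj₂ b′) u⊆v with () ← head-⊆ u⊆v refl
  halves (inj₂ b) (inj₁ a′) u⊆v =
    ⊥-elim (1+n≰n (subst₂ _≤_ (∣layer∣ m (suc j) b) (∣layer∣ m j a′) (p⊆q⇒∣p∣≤∣q∣ (drop-∷-⊆ u⊆v))))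
  halves (inj₂ b) (inj₂ b′) u⊆v = cong inj₂ (layer-antichain m (suc j) (drop-∷-⊆ u⊆v))

precompose : ∀ {n} {A B : Set} {R : A → A → Set} {S : B → B → Set} (g : A → B) →
  (∀ a a′ → (R a a′ → S (g a) (g a′)) × (S (g a) (g a′) → R a a′)) →
  OrderEmbedsInto S n → OrderEmbedsInto R n
precompose g g-emb (φ , φ-emb) =
  φ ∘ g , λ a a′ → proj₁ (φ-emb (g a) (g a′)) ∘ proj₁ (g-emb a a′) , proj₂ (g-emb a a′) ∘ proj₂ (φ-emb (g a) (g a′))

copy : ∀ {k n} (U : FinPoset) → CopiesEmbed k U n → Fin k → Embeds U n
copy U e i = precompose (i ,_) (λ x y → (refl ,_) , proj₂) e

fewerCopies : ∀ {k k′ n} (U : FinPoset) → k ≤ k′ → CopiesEmbed k′ U n → CopiesEmbed k U n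
fewerCopies U k≤k′ = precompose (λ (i , x) → Fin.inject≤ i k≤k′ , x) λ (i , x) (j , y) →
  (λ (i≡j , x≼y) → cong (λ i → Fin.inject≤ i k≤k′) i≡j , x≼y) ,
  (λ (i≡j , x≼y) → Finₚ.inject≤-injective k≤k′ k≤k′ i j i≡j , x≼y)

layerCopies : ∀ (U : FinPoset) {p} → Embeds U p → ∀ m j → CopiesEmbed (m choose j) U (p + m)
layerCopies U (φ , φ-emb) m j = ψ , ψ-emb
  where
  ψ : Fin (m choose j) × Fin (size U) → Subset _
  ψ (i , x) = φ x ++ layer m j i
  ψ-emb : ∀ a b → (CopyLe (m choose j) U a b → ψ a ⊆ ψ b) × (ψ a ⊆ ψ b → CopyLe (m choose j) U a b)
  ψ-emb (i , x) (i′ , y) =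
    (λ { (refl , x≼y) → ++⊆++ (proj₁ (φ-emb x y) x≼y) ⊆-refl }) ,
    λ ψa⊆ψb → let (φx⊆φy , i⊆i′) = ++⊆++⁻ (φ x) (φ y) ψa⊆ψb in
              layer-antichain m j i⊆i′ , proj₂ (φ-emb x y) φx⊆φy

-- Intervals of P([n])

label : Bool → Bool → Label
label _     false = inC
label true  true  = inA
label false true  = free

interval : ∀ {n} → Subset n → Subset n → Fin n → Label
interval lo hi y = label (lookup lo y) (lookup hi y)

project : ∀ {n} (lo hi : Subset n) → Subset n → Subset (count free (interval lo hi))
project []           []           []      = []
project (_     ∷ lo) (false ∷ hi) (_ ∷ u) = project lo hi u
project (true  ∷ lo) (true  ∷ hi) (_ ∷ u) = project lo hi u
project (false ∷ lo) (true  ∷ hi) (s ∷ u) = s ∷ project lo hi u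

project-mono : ∀ {n} (lo hi : Subset n) {u v} → u ⊆ v → project lo hi u ⊆ project lo hi v
project-mono []           []           {[]}    {[]}    _   = λ ()
project-mono (_     ∷ lo) (false ∷ hi) {_ ∷ _} {_ ∷ _} u⊆v = project-mono lo hi (drop-∷-⊆ u⊆v)
project-mono (true  ∷ lo) (true  ∷ hi) {_ ∷ _} {_ ∷ _} u⊆v = project-mono lo hi (drop-∷-⊆ u⊆v)
project-mono (false ∷ lo) (true  ∷ hi) {_ ∷ _} {_ ∷ _} u⊆v =
  ∷⊆∷ (head-⊆ u⊆v) (project-mono lo hi (drop-∷-⊆ u⊆v))

project-reflects : ∀ {n} (lo hi : Subset n) {u v} → u ⊆ hi → lo ⊆ v →
  project lo hi u ⊆ project lo hi v → u ⊆ v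
project-reflects []           []           {[]}    {[]}    _    _    _   = λ ()
project-reflects (_     ∷ lo) (false ∷ hi) {s ∷ _} {_ ∷ _} u⊆hi lo⊆v u⊆v =
  ∷⊆∷ (λ s≡true → ⊥-elim (Boolₚ.not-¬ refl (head-⊆ u⊆hi s≡true)))
      (project-reflects lo hi (drop-∷-⊆ u⊆hi) (drop-∷-⊆ lo⊆v) u⊆v)
project-reflects (true  ∷ lo) (true  ∷ hi) {_ ∷ _} {_ ∷ _} u⊆hi lo⊆v u⊆v =
  ∷⊆∷ (λ _ → head-⊆ lo⊆v refl) (project-reflects lo hi (drop-∷-⊆ u⊆hi) (drop-∷-⊆ lo⊆v) u⊆v)
project-reflects (false ∷ lo) (true  ∷ hi) {_ ∷ _} {_ ∷ _} u⊆hi lo⊆v u⊆v =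
  ∷⊆∷ (head-⊆ u⊆v) (project-reflects lo hi (drop-∷-⊆ u⊆hi) (drop-∷-⊆ lo⊆v) (drop-∷-⊆ u⊆v))

intervalEmbedding : ∀ {n} {A : Set} {R : A → A → Set} (lo hi : Subset n) (e : OrderEmbedsInto R n) →
  (∀ x → lo ⊆ proj₁ e x × proj₁ e x ⊆ hi) → OrderEmbedsInto R (count free (interval lo hi))
intervalEmbedding lo hi (φ , φ-emb) within =
  project lo hi ∘ φ , λ x y →
    project-mono lo hi ∘ proj₁ (φ-emb x y) ,
    proj₂ (φ-emb x y) ∘ project-reflects lo hi (proj₂ (within x)) (proj₁ (within y))

separated-suc : ∀ {n} {f g : Fin (suc n) → Label} → Separated (f ∘ Fin.suc) (g ∘ Fin.suc) → Separated f g
separated-suc (y , fy≡inA , gy≡inC) = Fin.suc y , fy≡inA , gy≡inC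

separatedIntervals : ∀ {n} {lo hi lo′ hi′ : Subset n} → lo ⊆ hi → lo ⊈ hi′ →
  Separated (interval lo hi) (interval lo′ hi′)
separatedIntervals {lo = []} {[]} {[]} {[]} _ lo⊈hi′ = ⊥-elim (lo⊈hi′ λ ())
separatedIntervals {lo = true ∷ _} {_ ∷ _} {_ ∷ _} {false ∷ _} lo⊆hi _
  with refl ← head-⊆ lo⊆hi refl = Fin.zero , refl , refl
separatedIntervals {lo = true ∷ _} {_ ∷ _} {_ ∷ lo′} {true ∷ _} lo⊆hi lo⊈hi′ =
  separated-suc (separatedIntervals {lo′ = lo′} (drop-∷-⊆ lo⊆hi) (lo⊈hi′ ∘ ∷⊆∷ (λ _ → refl)))
separatedIntervals {lo = false ∷ _} {_ ∷ _} {_ ∷ lo′} {_ ∷ _} lo⊆hi lo⊈hi′ =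
  separated-suc (separatedIntervals {lo′ = lo′} (drop-∷-⊆ lo⊆hi) (lo⊈hi′ ∘ ∷⊆∷ λ ()))

-- Bounds on Sp and Asp

!≤weight*s : ∀ {n p} (f : Fin n → Label) → p ≤ count free f → n ! ≤ weight f * s (n ∸ p)
!≤weight*s {n} {p} f p≤r = begin
  n !                            ≡⟨ cong _! (sym (count-total f)) ⟩
  (a + c + r) !                  ≡⟨ sym (orderings*choose≡! a c r) ⟩
  weight f * (a + c) choose a    ≤⟨ *-monoʳ-≤ (weight f) (choose-monoˡ-≤ a a+c≤n∸p) ⟩
  weight f * (n ∸ p) choose a    ≤⟨ *-monoʳ-≤ (weight f) (choose≤central (n ∸ p) a) ⟩
  weight f * (n ∸ p) choose ((n ∸ p) / 2)  ≡⟨ cong (weight f *_) (sym (s≡choose (n ∸ p))) ⟩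
  weight f * s (n ∸ p)           ∎
  where
  open ≤-Reasoning
  a = count inA f
  c = count inC f
  r = count free f
  a+c≤n∸p : a + c ≤ n ∸ p
  a+c≤n∸p = begin
    a + c          ≡⟨ sym (m+n∸n≡m (a + c) r) ⟩
    a + c + r ∸ r  ≡⟨ cong (_∸ r) (count-total f) ⟩
    n ∸ r          ≤⟨ ∸-monoʳ-≤ n p≤r ⟩
    n ∸ p          ∎

copies≤s : ∀ (U : FinPoset) {p k n} → IsMin (Embeds U) p → IsBounded U →
  CopiesEmbed k U n → k ≤ s (n ∸ p)
copies≤s U {p} {k} {n} (_ , minimal) ((bot , bot≼) , (top , ≼top)) e@(φ , φ-emb) =
  *-cancelʳ-≤ k S (n !) {{n !≢0}} (begin
    k * n !                       ≡⟨ sym (sum-const k (n !)) ⟩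
    sum {k} (λ _ → n !)           ≤⟨ sum-mono-≤ (λ i → !≤weight*s (L i) (p≤free i)) ⟩
    sum (λ i → weight (L i) * S)  ≡⟨ sym (*-distribʳ-sum S (weight ∘ L)) ⟩
    sum (weight ∘ L) * S          ≤⟨ *-monoˡ-≤ S (bollobás n L (λ _ → true) separated) ⟩
    n ! * S                       ≡⟨ *-comm (n !) S ⟩
    S * n !                       ∎)
  where
  open ≤-Reasoning
  S = s (n ∸ p)
  L : Fin k → Fin n → Label
  L i = interval (φ (i , bot)) (φ (i , top))
  monotone : ∀ {i x y} → _≼_ U x y → φ (i , x) ⊆ φ (i , y)
  monotone x≼y = proj₁ (φ-emb _ _) (refl , x≼y)
  p≤free : ∀ i → p ≤ count free (L i)
  p≤free i = minimal _ (intervalEmbedding _ _ (copy U e i) λ x → monotone (bot≼ x) , monotone (≼top x))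
  separated : PairwiseSeparated L (λ _ → true)
  separated {i} {j} i≢j _ _ =
    separatedIntervals {lo′ = φ (j , bot)} (monotone (bot≼ top)) (i≢j ∘ proj₁ ∘ proj₂ (φ-emb (i , bot) (j , top)))

sp-lower : ∀ (U : FinPoset) {p n} → Embeds U p → p ≤ n → CopiesEmbed (s (n ∸ p)) U n
sp-lower U {p} {n} e p≤n = subst₂ (λ k n → CopiesEmbed k U n) (sym (s≡choose (n ∸ p))) (m+[n∸m]≡n p≤n)
                                  (layerCopies U e (n ∸ p) ((n ∸ p) / 2))

asp-upper : ∀ (U : FinPoset) {p k m} → Embeds U p → k ≤ s m → CopiesEmbed k U (p + m)
asp-upper U {p} {m = m} e k≤sm = fewerCopies U k≤sm (subst (λ k → CopiesEmbed k U (p + m)) (sym (s≡choose m))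
                                                          (layerCopies U e m (m / 2)))

asp-lower : ∀ (U : FinPoset) {p k sk n} → IsMin (Embeds U) p → IsBounded U → 1 ≤ k →
  IsMin (λ m → k ≤ s m) sk → CopiesEmbed k U n → p + sk ≤ n
asp-lower U {p} {sk = sk} {n} minP@(_ , minimal) bounded (s≤s _) (_ , sk-minimal) e = begin
  p + sk       ≤⟨ +-monoʳ-≤ p (sk-minimal (n ∸ p) (copies≤s U minP bounded e)) ⟩
  p + (n ∸ p)  ≡⟨ m+[n∸m]≡n (minimal n (copy U e Fin.zero)) ⟩
  n            ∎
  where open ≤-Reasoning

mainTheorem2 : (U : FinPoset) (p : ℕ) → IsMin (λ p' → Embeds U p') p →
      ((n : ℕ) → p ≤ n → ∃ λ k' → s (n ∸ p) ≤ k' × CopiesEmbed k' U n)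
    × ((k : ℕ) → 1 ≤ k → (sk : ℕ) → IsMin (λ m → k ≤ s m) sk →
         ∃ λ n' → n' ≤ p + sk × CopiesEmbed k U n')
    × (IsBounded U → (n : ℕ) → p ≤ n → IsMax (λ k' → CopiesEmbed k' U n) (s (n ∸ p)))
    × (IsBounded U → (k : ℕ) → 1 ≤ k → (sk : ℕ) → IsMin (λ m → k ≤ s m) sk →
         IsMin (λ n' → CopiesEmbed k U n') (p + sk))
mainTheorem2 U p minP@(embeds , _) =
  (λ n p≤n → s (n ∸ p) , ≤-refl , sp-lower U embeds p≤n) ,
  (λ k _ sk (k≤s[sk] , _) → p + sk , ≤-refl , asp-upper U embeds k≤s[sk]) ,
  (λ bounded n p≤n → sp-lower U embeds p≤n , λ _ → copies≤s U minP bounded) ,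
  (λ bounded k 1≤k sk minSk → asp-upper U embeds (proj₁ minSk) , λ _ → asp-lower U minP bounded 1≤k minSk)
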